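{- Let $(P,\le,{}^*,0,1)$ be a pseudocomplemented poset and $A\subseteq P$, and assume that the supremum $\bigvee A$ exists in $(P,\le)$. Then (i) the infimum $\bigwedge A^*$ of $A^*=\{x^*\mid x\in A\}$ exists in $(P,\le)$ and $\bigwedge A^*=(\bigvee A)^*$; (ii) $A^\perp=(\bigvee A)^\perp$.
   Context: A bounded poset $(P,\le,0,1)$ is pseudocomplemented if for each $x\in P$ there exists a greatest element $y\in P$ such that the infimum $x\wedge y$ exists and equals $0$; it is denoted $x^*$. The orthogonality relation is $x\perp y$ iff $y\le x^*$. For $A\subseteq P$, $A^\perp:=\{x\in P\mid x\perp y\text{ for all }y\in A\}$, and $a^\perp:=\{a\}^\perp$. -}

module Defs where

open import Level using (Level; _⊔_; suc)
open import Data.Product using (_×_; Σ; ∃)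
open import Relation.Unary using (Pred; _∈_)
open import Relation.Binary.Bundles using (Poset)

module _ {c ℓ₁ ℓ₂ : Level} (P : Poset c ℓ₁ ℓ₂) where
  open Poset P

  IsMeetOf : Carrier → Carrier → Carrier → Set (c ⊔ ℓ₂)
  IsMeetOf x y m = (m ≤ x × m ≤ y) × (∀ z → z ≤ x → z ≤ y → z ≤ m)

  IsSup : {ℓ : Level} → Pred Carrier ℓ → Carrier → Set (c ⊔ ℓ ⊔ ℓ₂)
  IsSup A s = (∀ x → x ∈ A → x ≤ s) × (∀ u → (∀ x → x ∈ A → x ≤ u) → s ≤ u)

  IsInf : {ℓ : Level} → Pred Carrier ℓ → Carrier → Set (c ⊔ ℓ ⊔ ℓ₂)
  IsInf A m = (∀ x → x ∈ A → m ≤ x) × (∀ l → (∀ x → x ∈ A → l ≤ x) → l ≤ m)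

record PseudocomplementedPoset (c ℓ₁ ℓ₂ : Level) : Set (suc (c ⊔ ℓ₁ ⊔ ℓ₂)) where
  field
    poset : Poset c ℓ₁ ℓ₂
  open Poset poset public
  field
    𝟘 : Carrier
    𝟙 : Carrier
    𝟘-least    : ∀ x → 𝟘 ≤ x
    𝟙-greatest : ∀ x → x ≤ 𝟙
    _* : Carrier → Carrier
    *-meet     : ∀ x → IsMeetOf poset x (x *) 𝟘
    *-greatest : ∀ x y → IsMeetOf poset x y 𝟘 → y ≤ x *

  _⊥_ : Carrier → Carrier → Set ℓ₂
  x ⊥ y = y ≤ x *

  _^* : {ℓ : Level} → Pred Carrier ℓ → Pred Carrier (c ⊔ ℓ ⊔ ℓ₁)
  (A ^*) z = ∃ λ x → x ∈ A × z ≈ x *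

  _^⊥ : {ℓ : Level} → Pred Carrier ℓ → Pred Carrier (c ⊔ ℓ ⊔ ℓ₂)
  (A ^⊥) x = ∀ y → y ∈ A → x ⊥ y

  _^⊥₁ : Carrier → Pred Carrier ℓ₂
  (a ^⊥₁) x = x ⊥ a

-- The orthogonality relation is symmetric: y ≤ x* says that x ∧ y = 0, so x ≤ y*.
-- Hence * is antitone and x ≤ y* ⇔ y ≤ x*, i.e. * is a Galois connection
-- of (P, ≤) with its dual. Such a map sends suprema to infima, giving (i);
-- and x ⊥ y for all y ∈ A means A ⊆ ↓x*, i.e. ⋁ A ≤ x*, giving (ii).
module Submission where

open import Defs
open import Level using (Level)
open import Data.Product using (_×_; _,_; proj₁; proj₂)
open import Relation.Unary using (Pred; _∈_)
open import Function.Bundles using (_⇔_; mk⇔)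

module Pseudocomplement {c ℓ₁ ℓ₂ : Level} (P : PseudocomplementedPoset c ℓ₁ ℓ₂) where
  open PseudocomplementedPoset P

  ⊥-sym : ∀ {x y} → x ⊥ y → y ⊥ x
  ⊥-sym {x} {y} y≤x* = *-greatest y x ((𝟘-least y , 𝟘-least x) , lower-bound⇒≤𝟘)
    where
    lower-bound⇒≤𝟘 : ∀ z → z ≤ y → z ≤ x → z ≤ 𝟘
    lower-bound⇒≤𝟘 z z≤y z≤x = proj₂ (*-meet x) z z≤x (trans z≤y y≤x*)

  ≤-** : ∀ x → x ≤ x * *
  ≤-** x = ⊥-sym {x} {x *} refl

  *-antitone : ∀ {x y} → x ≤ y → y * ≤ x *
  *-antitone {x} {y} x≤y = ⊥-sym {y *} {x} (trans x≤y (≤-** y))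

  module _ {ℓ : Level} {A : Pred Carrier ℓ} {s : Carrier} (sup : IsSup poset A s) where
    private
      upper : ∀ x → x ∈ A → x ≤ s
      upper = proj₁ sup
      least : ∀ u → (∀ x → x ∈ A → x ≤ u) → s ≤ u
      least = proj₂ sup

    sup⇒inf-* : IsInf poset (A ^*) (s *)
    sup⇒inf-* = lower , greatest
      where
      lower : ∀ z → z ∈ (A ^*) → s * ≤ z
      lower z (x , x∈A , z≈x*) = trans (*-antitone (upper x x∈A)) (reflexive (Eq.sym z≈x*))

      greatest : ∀ l → (∀ z → z ∈ (A ^*) → l ≤ z) → l ≤ s *
      greatest l l≤A* = ⊥-sym {l} {s} (least (l *) A≤l*)
        where
        A≤l* : ∀ x → x ∈ A → x ≤ l *
        A≤l* x x∈A = ⊥-sym {x} {l} (l≤A* (x *) (x , x∈A , Eq.refl))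

    ^⊥⇔sup^⊥₁ : ∀ x → x ∈ (A ^⊥) ⇔ x ∈ (s ^⊥₁)
    ^⊥⇔sup^⊥₁ x = mk⇔ (least (x *)) (λ s≤x* y y∈A → trans (upper y y∈A) s≤x*)

lemma2 : {c ℓ₁ ℓ₂ ℓ : Level} (P : PseudocomplementedPoset c ℓ₁ ℓ₂)
    → let open PseudocomplementedPoset P in
    (A : Pred Carrier ℓ) (s : Carrier) → IsSup poset A s
    → IsInf poset (A ^*) (s *) × (∀ x → (x ∈ (A ^⊥)) ⇔ (x ∈ (s ^⊥₁)))
lemma2 P A s sup = sup⇒inf-* sup , ^⊥⇔sup^⊥₁ sup
  where open Pseudocomplement P
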